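{- Let $K$ be a field and let $F=(F_1,\ldots,F_n)\in K[X_1,\ldots,X_n]^n$ be an invertible polynomial map of the form $F_i=X_i+H_i$, where $H_i$ is a polynomial of degree $D_i$ and lower degree $d_i\ge 2$; put $d=\min_i d_i$ and $D=\max_i D_i$. Let $G=(G_1,\ldots,G_n)$ be the polynomial inverse of $F$. Let $P_0(X)=X$, $P_{l+1}=P_l\circ F-P_l$, and for $m\ge1$ put $R^i_m:=\sum_{j=0}^{m-1}(-1)^jP^i_j-G_i$. Let $t$ be a new variable, $\widehat{F}(X)=t^{ -1}F(tX)$, $\widehat{G}(X)=t^{ -1}G(tX)$, $Q_0(X)=X$, $Q_{l+1}=Q_l\circ\widehat F-Q_l$, and $S^i_m:=\sum_{j=0}^{m-1}(-1)^jQ^i_j-\widehat{G}_i$. Then for every $i=1,\ldots,n$ and every integer $m>\frac{D^{n-1}-d_i}{d-1}+1$ we have \[ S^i_m(X)=\widehat{R}^i_m(X)\quad\text{and}\quad S^i_m(\widehat{F})=(-1)^{m+1}\widehat{P}^i_m(X),\] where $\widehat{R}^i_m(X)=t^{ -1}R^i_m(tX)$ and $\widehat{P}^i_m(X)=t^{ -1}P^i_m(tX)$.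
   Context: The lower degree of a polynomial is the minimal total degree of a monomial appearing in it with nonzero coefficient. Superscript $i$ denotes the $i$-th component of a polynomial map. For a polynomial (map) $P$ vanishing at $0$, $t^{ -1}P(tX)$ is the polynomial (map) over $K[t]$ obtained by substituting $tX=(tX_1,\ldots,tX_n)$ and dividing by $t$. -}

module Defs where

open import Level using (Level; _⊔_) renaming (suc to lsuc)
open import Algebra.Bundles using (CommutativeRing)
open import Data.Nat as ℕ using (ℕ; zero; suc; _<_; _≤_; _∸_)
open import Data.Fin using (Fin; zero; suc)
open import Data.Vec as Vec using (Vec; []; _∷_)
open import Data.Vec.Properties using (≡-dec)
open import Data.List as List using (List; []; _∷_; _++_)
open import Data.Product using (_×_; _,_; ∃; ∃-syntax; Σ)
open import Relation.Nullary using (¬_; yes; no)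
open import Relation.Binary.PropositionalEquality using (_≡_)

record Field (c ℓ : Level) : Set (lsuc (c ⊔ ℓ)) where
  field
    commRing : CommutativeRing c ℓ
  open CommutativeRing commRing public
  field
    1≉0     : ¬ (1# ≈ 0#)
    inverse : ∀ x → ¬ (x ≈ 0#) → ∃[ y ] (x * y ≈ 1#)

-- Multivariate polynomials over a field K, represented as finite lists of
-- terms (coefficient, exponent vector); two polynomials are equal when all
-- their coefficients agree (so the representation is only relevant up to ≈P).
module Polynomials {c ℓ : Level} (K : Field c ℓ) where
  open Field K using (Carrier; _≈_; _+_; _*_; -_; 0#; 1#)

  Mono : ℕ → Set
  Mono n = Vec ℕ n

  ∣_∣ₘ : ∀ {n} → Mono n → ℕ
  ∣ α ∣ₘ = Vec.sum α

  Poly : ℕ → Set c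
  Poly n = List (Carrier × Mono n)

  coeff : ∀ {n} → Poly n → Mono n → Carrier
  coeff [] α = 0#
  coeff ((a , β) ∷ p) α with ≡-dec ℕ._≟_ β α
  ... | yes _ = a + coeff p α
  ... | no  _ = coeff p α

  infix 4 _≈P_
  _≈P_ : ∀ {n} → Poly n → Poly n → Set ℓ
  p ≈P q = ∀ α → coeff p α ≈ coeff q α

  0P : ∀ {n} → Poly n
  0P = []

  constP : ∀ {n} → Carrier → Poly n
  constP {n} a = (a , Vec.replicate n 0) ∷ []

  1P : ∀ {n} → Poly n
  1P = constP 1#

  var : ∀ {n} → Fin n → Poly n
  var {n} i = (1# , Vec.updateAt (Vec.replicate n 0) i (λ _ → 1)) ∷ []

  infixl 6 _+P_ _-P_
  infixl 7 _*P_
  _+P_ : ∀ {n} → Poly n → Poly n → Poly n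
  p +P q = p ++ q

  -P_ : ∀ {n} → Poly n → Poly n
  -P p = List.map (λ { (a , α) → (- a , α) }) p

  _-P_ : ∀ {n} → Poly n → Poly n → Poly n
  p -P q = p +P (-P q)

  _*P_ : ∀ {n} → Poly n → Poly n → Poly n
  p *P q = List.concatMap (λ { (a , α) →
             List.map (λ { (b , β) → (a * b , Vec.zipWith ℕ._+_ α β) }) q }) p

  _^P_ : ∀ {n} → Poly n → ℕ → Poly n
  p ^P zero  = 1P
  p ^P suc k = p *P (p ^P k)

  monoSubst : ∀ {n m} → Mono n → (Fin n → Poly m) → Poly m
  monoSubst []      s = 1P
  monoSubst (k ∷ α) s = (s zero ^P k) *P monoSubst α (λ j → s (suc j))

  subst : ∀ {n m} → Poly n → (Fin n → Poly m) → Poly m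
  subst [] s = 0P
  subst ((a , α) ∷ p) s = (constP a *P monoSubst α s) +P subst p s

  PolyMap : ℕ → Set c
  PolyMap n = Fin n → Poly n

  idMap : ∀ {n} → PolyMap n
  idMap = var

  _∘P_ : ∀ {n} → PolyMap n → PolyMap n → PolyMap n
  (P ∘P F) i = subst (P i) F

  _≈M_ : ∀ {n} → PolyMap n → PolyMap n → Set ℓ
  P ≈M Q = ∀ i → P i ≈P Q i

  HasDegree : ∀ {n} → Poly n → ℕ → Set ℓ
  HasDegree p D = (∀ α → D < ∣ α ∣ₘ → coeff p α ≈ 0#)
                × ∃[ α ] (∣ α ∣ₘ ≡ D × ¬ (coeff p α ≈ 0#))

  HasLowerDegree : ∀ {n} → Poly n → ℕ → Set ℓ
  HasLowerDegree p d = (∀ α → ∣ α ∣ₘ < d → coeff p α ≈ 0#)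
                     × ∃[ α ] (∣ α ∣ₘ ≡ d × ¬ (coeff p α ≈ 0#))

  XplusH : ∀ {n} → PolyMap n → PolyMap n
  XplusH H i = var i +P H i

  signed : ∀ {n} → ℕ → Poly n → Poly n
  signed zero          p = p
  signed (suc zero)    p = -P p
  signed (suc (suc j)) p = signed j p

  altSum : ∀ {n} → ℕ → (ℕ → Poly n) → Poly n
  altSum zero    f = 0P
  altSum (suc m) f = altSum m f +P signed m (f m)

  Pseq : ∀ {n} → PolyMap n → ℕ → PolyMap n
  Pseq F zero    = idMap
  Pseq F (suc l) i = (Pseq F l ∘P F) i -P Pseq F l i

  Rseq : ∀ {n} → PolyMap n → PolyMap n → ℕ → PolyMap n
  Rseq F G m i = altSum m (λ j → Pseq F j i) -P G i

  -- Polynomials over K[t]: polynomials in n+1 variables, where the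
  -- variable with index zero is t and the variable suc j is X_{j+1}.

  tvar : ∀ {n} → Poly (suc n)
  tvar = var zero

  Xvar : ∀ {n} → Fin n → Poly (suc n)
  Xvar j = var (suc j)

  -- P̂(X) = t^{-1} P(tX): the term a X^α becomes a t^{|α|-1} X^α.
  -- (Used only for polynomials vanishing at 0.)
  hat : ∀ {n} → Poly n → Poly (suc n)
  hat p = List.map (λ { (a , α) → (a , (∣ α ∣ₘ ∸ 1) ∷ α) }) p

  hatMap : ∀ {n} → PolyMap n → Fin n → Poly (suc n)
  hatMap F i = hat (F i)

  substT : ∀ {n} → Poly (suc n) → (Fin n → Poly (suc n)) → Poly (suc n)
  substT p Φ = subst p (λ { zero → tvar ; (suc j) → Φ j })

  Qseq : ∀ {n} → PolyMap n → ℕ → Fin n → Poly (suc n)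
  Qseq F zero      i = Xvar i
  Qseq F (suc l)   i = substT (Qseq F l i) (hatMap F) -P Qseq F l i

  Sseq : ∀ {n} → PolyMap n → PolyMap n → ℕ → Fin n → Poly (suc n)
  Sseq F G m i = altSum m (λ j → Qseq F j i) -P hat (G i)

maxFin : ∀ {n} → (Fin n → ℕ) → ℕ
maxFin {n} f = Vec.foldr (λ _ → ℕ) ℕ._⊔_ 0 (Vec.tabulate f)

-- minimum of finitely many naturals (n ≥ 1 needed for meaning; empty ↦ 0)
minFin : ∀ {n} → (Fin n → ℕ) → ℕ
minFin {zero}  f = 0
minFin {suc n} f = Vec.foldr (λ _ → ℕ) ℕ._⊓_ (f zero) (Vec.tabulate (λ j → f (suc j)))

module Submission where

-- The theorem follows from two
-- identities that hold for every m:
--   (1) the hat operation P ↦ P̂ = t⁻¹P(tX) commutes with composition,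
--       (P ∘ F)^ = P̂ ∘ F̂; hence Q_l = P̂_l by induction on l, and since hat is
--       additive, S_m = R̂_m;
--   (2) R_m ∘ F = (-1)^(m+1) P_m, because Σ_{j<m} (-1)^j (P_j ∘ F) telescopes
--       against Σ_{j<m} (-1)^j P_j using P_j ∘ F = P_{j+1} + P_j, and G ∘ F = X.
-- Then S_m ∘ F̂ = R̂_m ∘ F̂ = (R_m ∘ F)^ = (-1)^(m+1) P̂_m.

open import Defs
open import Data.Nat as ℕ using (ℕ; zero; suc; _∸_; _≤_; s≤s)
import Data.Nat.Properties as ℕP
open import Data.Nat.Tactic.RingSolver using (solve-∀)
open import Data.Fin using (Fin; zero; suc)
open import Data.Vec as Vec using ([]; _∷_)
open import Data.Vec.Properties using (≡-dec; ∷-injectiveˡ; ∷-injectiveʳ)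
open import Data.List as List using ([]; _∷_; _++_)
import Data.List.Properties as ListP
open import Data.Product using (_×_; _,_; proj₁; proj₂)
open import Data.Sum using (_⊎_; inj₁; inj₂)
open import Data.Empty using (⊥-elim)
open import Relation.Nullary using (¬_; Dec; yes; no)
open import Relation.Binary.Bundles using (Setoid)
open import Relation.Binary.PropositionalEquality as P using (_≡_)
import Relation.Binary.Reasoning.Setoid as SetoidReasoning
import Algebra.Properties.CommutativeSemigroup as CommSemigroupProperties
import Algebra.Properties.Ring as RingProperties

-- Arithmetic on ℕ for the weight bookkeeping.  A weight (c, e) on a monomial
-- t^k X^α is the constraint k + c = |α| + e.

+-interchange : ∀ a b c d → (a ℕ.+ b) ℕ.+ (c ℕ.+ d) ≡ (a ℕ.+ c) ℕ.+ (b ℕ.+ d)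
+-interchange = CommSemigroupProperties.interchange ℕP.+-commutativeSemigroup

balance-shift : ∀ k a c e c' e' → c ℕ.+ e' ≡ c' ℕ.+ e →
                k ℕ.+ c ≡ a ℕ.+ e → k ℕ.+ c' ≡ a ℕ.+ e'
balance-shift k a c e c' e' shift balanced = ℕP.+-cancelʳ-≡ e _ _ (begin
  (k + c') + e  ≡⟨ +-assoc k c' e ⟩
  k + (c' + e)  ≡⟨ P.cong (k +_) (P.sym shift) ⟩
  k + (c + e')  ≡⟨ P.sym (+-assoc k c e') ⟩
  (k + c) + e'  ≡⟨ P.cong (_+ e') balanced ⟩
  (a + e) + e'  ≡⟨ xy∙z≈xz∙y a e e' ⟩
  (a + e') + e  ∎)
  where
  open import Data.Nat using (_+_)
  open ℕP using (+-assoc)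
  open CommSemigroupProperties ℕP.+-commutativeSemigroup using (xy∙z≈xz∙y)
  open P.≡-Reasoning

balance-+ : ∀ k₁ k₂ a₁ a₂ c e c' e' → k₁ ℕ.+ c ≡ a₁ ℕ.+ e → k₂ ℕ.+ c' ≡ a₂ ℕ.+ e' →
            (k₁ ℕ.+ k₂) ℕ.+ (c ℕ.+ c') ≡ (a₁ ℕ.+ a₂) ℕ.+ (e ℕ.+ e')
balance-+ k₁ k₂ a₁ a₂ c e c' e' balanced₁ balanced₂ =
  P.trans (+-interchange k₁ k₂ c c')
    (P.trans (P.cong₂ ℕ._+_ balanced₁ balanced₂) (+-interchange a₁ e a₂ e'))

balance-1-0 : ∀ {k a} → k ℕ.+ 1 ≡ a ℕ.+ 0 → k ≡ a ∸ 1
balance-1-0 {k} {a} balanced = P.trans (P.sym (ℕP.m+n∸n≡m k 1))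
  (P.cong (_∸ 1) (P.trans balanced (ℕP.+-identityʳ a)))

module Coefficients {c ℓ} (K : Field c ℓ) where
  open Field K hiding (zero)
  open Polynomials K
  open SetoidReasoning setoid
  open RingProperties ring
    using (-0#≈0#; -‿+-comm; -‿involutive; -‿distribˡ-*; x[y-z]≈xy-xz; x∙y⁻¹≈ε⇒x≈y;
           //-rightDividesˡ; //-rightDividesʳ)
  open CommSemigroupProperties +-commutativeSemigroup using (interchange; x∙yz≈y∙xz)

  _⊕_ : ∀ {n} → Mono n → Mono n → Mono n
  α ⊕ β = Vec.zipWith ℕ._+_ α β

  zeros : ∀ n → Mono n
  zeros n = Vec.replicate n 0

  zeros⊕ : ∀ {n} (β : Mono n) → zeros n ⊕ β ≡ β
  zeros⊕ []      = P.refl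
  zeros⊕ (x ∷ β) = P.cong (x ∷_) (zeros⊕ β)

  ∣zeros∣ : ∀ n → ∣ zeros n ∣ₘ ≡ 0
  ∣zeros∣ zero    = P.refl
  ∣zeros∣ (suc n) = ∣zeros∣ n

  ∣∣≡0⇒zeros : ∀ {n} (α : Mono n) → ∣ α ∣ₘ ≡ 0 → α ≡ zeros n
  ∣∣≡0⇒zeros []          _  = P.refl
  ∣∣≡0⇒zeros (zero ∷ α)  eq = P.cong (0 ∷_) (∣∣≡0⇒zeros α eq)

  unitMono : ∀ {n} → Fin n → Mono n
  unitMono {n} i = Vec.updateAt (zeros n) i (λ _ → 1)

  ∣unitMono∣ : ∀ {n} (i : Fin n) → ∣ unitMono i ∣ₘ ≡ 1
  ∣unitMono∣ {suc n} zero    = P.cong suc (∣zeros∣ n)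
  ∣unitMono∣         (suc i) = ∣unitMono∣ i

  ∣⊕∣ : ∀ {n} (α β : Mono n) → ∣ α ⊕ β ∣ₘ ≡ ∣ α ∣ₘ ℕ.+ ∣ β ∣ₘ
  ∣⊕∣ []      []      = P.refl
  ∣⊕∣ (x ∷ α) (y ∷ β) = P.trans (P.cong ((x ℕ.+ y) ℕ.+_) (∣⊕∣ α β)) (+-interchange x y _ _)

  lin : ∀ {n} → (Mono n → Carrier) → Poly n → Carrier
  lin f []            = 0#
  lin f ((a , α) ∷ p) = a * f α + lin f p

  lin-++ : ∀ {n} (f : Mono n → Carrier) p q → lin f (p ++ q) ≈ lin f p + lin f q
  lin-++ f []            q = sym (+-identityˡ _)
  lin-++ f ((a , α) ∷ p) q = trans (+-congˡ (lin-++ f p q)) (sym (+-assoc _ _ _))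

  lin-neg : ∀ {n} (f : Mono n → Carrier) p → lin f (-P p) ≈ - lin f p
  lin-neg f []            = sym -0#≈0#
  lin-neg f ((a , α) ∷ p) = begin
    - a * f α + lin f (-P p)  ≈⟨ +-cong (sym (-‿distribˡ-* a (f α))) (lin-neg f p) ⟩
    - (a * f α) + - lin f p   ≈⟨ -‿+-comm _ _ ⟩
    - (a * f α + lin f p)     ∎

  lin-cong : ∀ {n} {f g : Mono n → Carrier} p → (∀ α → f α ≈ g α) → lin f p ≈ lin g p
  lin-cong []            f≈g = refl
  lin-cong ((a , α) ∷ p) f≈g = +-cong (*-congˡ (f≈g α)) (lin-cong p f≈g)

  lin-sub : ∀ {n} (f g : Mono n → Carrier) p → lin (λ α → f α - g α) p ≈ lin f p - lin g p
  lin-sub f g []            = sym (-‿inverseʳ 0#)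
  lin-sub f g ((a , α) ∷ p) = begin
    a * (f α - g α) + lin (λ α → f α - g α) p  ≈⟨ +-cong (x[y-z]≈xy-xz a (f α) (g α)) (lin-sub f g p) ⟩
    (a * f α - a * g α) + (lin f p - lin g p)   ≈⟨ interchange _ _ _ _ ⟩
    (a * f α + lin f p) + (- (a * g α) + - lin g p) ≈⟨ +-congˡ (-‿+-comm _ _) ⟩
    (a * f α + lin f p) - (a * g α + lin g p)  ∎

  -- Multiplying every term of q by the term a X^α scales the functional by a
  -- and shifts its weight by α.  (The map is given up to pointwise equality,
  -- since it arises as an anonymous function inside _*P_.)
  lin-shift : ∀ {n} (f : Mono n → Carrier) a α (g : Carrier × Mono n → Carrier × Mono n) →
              (∀ b β → g (b , β) ≡ (a * b , α ⊕ β)) → ∀ q →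
              lin f (List.map g q) ≈ a * lin (λ β → f (α ⊕ β)) q
  lin-shift f a α g g≡ []            = sym (zeroʳ a)
  lin-shift f a α g g≡ ((b , β) ∷ q) rewrite g≡ b β = begin
    a * b * f (α ⊕ β) + lin f (List.map g q)               ≈⟨ +-cong (*-assoc a b _) (lin-shift f a α g g≡ q) ⟩
    a * (b * f (α ⊕ β)) + a * lin (λ β → f (α ⊕ β)) q     ≈⟨ sym (distribˡ a _ _) ⟩
    a * (b * f (α ⊕ β) + lin (λ β → f (α ⊕ β)) q)         ∎

  lin-* : ∀ {n} (f : Mono n → Carrier) p q →
          lin f (p *P q) ≈ lin (λ α → lin (λ β → f (α ⊕ β)) q) p
  lin-* f []            q = refl
  lin-* f ((a , α) ∷ p) q = trans (lin-++ f (List.map _ q) (p *P q))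
    (+-cong (lin-shift f a α _ (λ _ _ → P.refl) q) (lin-* f p q))

  indicator : ∀ {n} → Mono n → Mono n → Carrier
  indicator γ β with ≡-dec ℕ._≟_ β γ
  ... | yes _ = 1#
  ... | no  _ = 0#

  indicator-self : ∀ {n} (γ : Mono n) → indicator γ γ ≈ 1#
  indicator-self γ with ≡-dec ℕ._≟_ γ γ
  ... | yes _  = refl
  ... | no γ≢γ = ⊥-elim (γ≢γ P.refl)

  indicator-other : ∀ {n} {γ β : Mono n} → ¬ (β ≡ γ) → indicator γ β ≈ 0#
  indicator-other {γ = γ} {β} β≢γ with ≡-dec ℕ._≟_ β γ
  ... | yes β≡γ = ⊥-elim (β≢γ β≡γ)
  ... | no  _   = refl

  coeff-as-lin : ∀ {n} (p : Poly n) γ → coeff p γ ≈ lin (indicator γ) p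
  coeff-as-lin []            γ = refl
  coeff-as-lin ((a , β) ∷ p) γ with ≡-dec ℕ._≟_ β γ
  ... | yes _ = +-cong (sym (*-identityʳ a)) (coeff-as-lin p γ)
  ... | no  _ = trans (sym (+-identityˡ _)) (+-cong (sym (zeroʳ a)) (coeff-as-lin p γ))

  coeff-head-on : ∀ {n} a α (p : Poly n) → coeff ((a , α) ∷ p) α ≈ a + coeff p α
  coeff-head-on a α p with ≡-dec ℕ._≟_ α α
  ... | yes _  = refl
  ... | no α≢α = ⊥-elim (α≢α P.refl)

  coeff-head-off : ∀ {n} a {β γ} (p : Poly n) → ¬ (β ≡ γ) → coeff ((a , β) ∷ p) γ ≈ coeff p γ
  coeff-head-off a {β} {γ} p β≢γ with ≡-dec ℕ._≟_ β γ
  ... | yes β≡γ = ⊥-elim (β≢γ β≡γ)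
  ... | no  _   = refl

  coeff-++ : ∀ {n} (p q : Poly n) γ → coeff (p ++ q) γ ≈ coeff p γ + coeff q γ
  coeff-++ p q γ = trans (coeff-as-lin (p ++ q) γ) (trans (lin-++ (indicator γ) p q)
                     (sym (+-cong (coeff-as-lin p γ) (coeff-as-lin q γ))))

  coeff-neg : ∀ {n} (p : Poly n) γ → coeff (-P p) γ ≈ - coeff p γ
  coeff-neg p γ = trans (coeff-as-lin (-P p) γ)
    (trans (lin-neg (indicator γ) p) (-‿cong (sym (coeff-as-lin p γ))))

  coeff-sub : ∀ {n} (p q : Poly n) γ → coeff (p -P q) γ ≈ coeff p γ - coeff q γ
  coeff-sub p q γ = trans (coeff-++ p (-P q) γ) (+-congˡ (coeff-neg q γ))

  without : ∀ {n} → Mono n → Poly n → Poly n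
  without α []            = []
  without α ((b , β) ∷ p) with ≡-dec ℕ._≟_ β α
  ... | yes _ = without α p
  ... | no  _ = (b , β) ∷ without α p

  without-length : ∀ {n} α (p : Poly n) → List.length (without α p) ≤ List.length p
  without-length α []            = ℕ.z≤n
  without-length α ((b , β) ∷ p) with ≡-dec ℕ._≟_ β α
  ... | yes _ = ℕP.m≤n⇒m≤1+n (without-length α p)
  ... | no  _ = s≤s (without-length α p)

  without-head : ∀ {n} a α (p : Poly n) → without α ((a , α) ∷ p) ≡ without α p
  without-head a α p with ≡-dec ℕ._≟_ α α
  ... | yes _  = P.refl
  ... | no α≢α = ⊥-elim (α≢α P.refl)

  coeff-without-self : ∀ {n} α (p : Poly n) → coeff (without α p) α ≈ 0#
  coeff-without-self α []            = refl
  coeff-without-self α ((b , β) ∷ p) with ≡-dec ℕ._≟_ β α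
  ... | yes _  = coeff-without-self α p
  ... | no β≢α = trans (coeff-head-off b (without α p) β≢α) (coeff-without-self α p)

  coeff-without-other : ∀ {n} α γ (p : Poly n) → ¬ (γ ≡ α) → coeff (without α p) γ ≈ coeff p γ
  coeff-without-other α γ []            γ≢α = refl
  coeff-without-other α γ ((b , β) ∷ p) γ≢α with ≡-dec ℕ._≟_ β α
  ... | yes P.refl = trans (coeff-without-other α γ p γ≢α)
                       (sym (coeff-head-off b p (λ α≡γ → γ≢α (P.sym α≡γ))))
  ... | no _ with ≡-dec ℕ._≟_ β γ
  ...   | yes _ = +-congˡ (coeff-without-other α γ p γ≢α)
  ...   | no  _ = coeff-without-other α γ p γ≢α

  lin-extract : ∀ {n} (f : Mono n → Carrier) α p → lin f p ≈ coeff p α * f α + lin f (without α p)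
  lin-extract f α []            = sym (trans (+-identityʳ _) (zeroˡ _))
  lin-extract f α ((b , β) ∷ p) with ≡-dec ℕ._≟_ β α
  ... | yes P.refl = begin
    b * f β + lin f p                                  ≈⟨ +-congˡ (lin-extract f β p) ⟩
    b * f β + (coeff p β * f β + lin f (without β p))  ≈⟨ sym (+-assoc _ _ _) ⟩
    (b * f β + coeff p β * f β) + lin f (without β p)  ≈⟨ +-congʳ (sym (distribʳ (f β) b (coeff p β))) ⟩
    (b + coeff p β) * f β + lin f (without β p)        ∎
  ... | no _ = trans (+-congˡ (lin-extract f α p)) (x∙yz≈y∙xz _ _ _)

  lin-vanishes : ∀ {n} (f : Mono n → Carrier) p → (∀ α → coeff p α * f α ≈ 0#) → lin f p ≈ 0#
  lin-vanishes f p = go (List.length p) p ℕP.≤-refl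
    where
    go : ∀ N p → List.length p ≤ N → (∀ α → coeff p α * f α ≈ 0#) → lin f p ≈ 0#
    go N       []                _           _     = refl
    go (suc N) q@((a , α) ∷ p) (s≤s |p|≤N) kills = begin
      lin f q                                ≈⟨ lin-extract f α q ⟩
      coeff q α * f α + lin f (without α q)  ≈⟨ +-cong (kills α) (go N (without α q) shorter kills′) ⟩
      0# + 0#                                ≈⟨ +-identityʳ 0# ⟩
      0#                                     ∎
      where
      shorter : List.length (without α q) ≤ N
      shorter rewrite without-head a α p = ℕP.≤-trans (without-length α p) |p|≤N
      kills′ : ∀ β → coeff (without α q) β * f β ≈ 0#
      kills′ β with ≡-dec ℕ._≟_ β α
      ... | yes P.refl = trans (*-congʳ (coeff-without-self α q)) (zeroˡ _)
      ... | no β≢α     = trans (*-congʳ (coeff-without-other α β q β≢α)) (kills β)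

  lin-resp : ∀ {n} (f : Mono n → Carrier) p q → p ≈P q → lin f p ≈ lin f q
  lin-resp f p q p≈q = x∙y⁻¹≈ε⇒x≈y _ _ (begin
    lin f p - lin f q       ≈⟨ +-congˡ (sym (lin-neg f q)) ⟩
    lin f p + lin f (-P q)  ≈⟨ sym (lin-++ f p (-P q)) ⟩
    lin f (p ++ -P q)       ≈⟨ lin-vanishes f (p ++ -P q) cancels ⟩
    0#                      ∎)
    where
    cancels : ∀ α → coeff (p ++ -P q) α * f α ≈ 0#
    cancels α = trans (*-congʳ (begin
      coeff (p -P q) α       ≈⟨ coeff-sub p q α ⟩
      coeff p α - coeff q α  ≈⟨ +-congʳ (p≈q α) ⟩
      coeff q α - coeff q α  ≈⟨ -‿inverseʳ _ ⟩
      0#                          ∎)) (zeroˡ _)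

  lin-agree : ∀ {n} (f g : Mono n → Carrier) p → (∀ α → coeff p α ≈ 0# ⊎ f α ≈ g α) →
              lin f p ≈ lin g p
  lin-agree f g p agree = x∙y⁻¹≈ε⇒x≈y _ _ (trans (sym (lin-sub f g p)) (lin-vanishes _ p kills))
    where
    kills : ∀ α → coeff p α * (f α - g α) ≈ 0#
    kills α with agree α
    ... | inj₁ absent = trans (*-congʳ absent) (zeroˡ _)
    ... | inj₂ f≈g    = trans (*-congˡ (trans (+-congʳ f≈g) (-‿inverseʳ _))) (zeroʳ _)

  ≈P-setoid : ℕ → Setoid c ℓ
  ≈P-setoid n = record
    { Carrier       = Poly n
    ; _≈_           = _≈P_
    ; isEquivalence = record
      { refl  = λ _ → refl
      ; sym   = λ p≈q α → sym (p≈q α)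
      ; trans = λ p≈q q≈r α → trans (p≈q α) (q≈r α)
      }
    }

  ++-cong : ∀ {n} {p p' q q' : Poly n} → p ≈P p' → q ≈P q' → p ++ q ≈P p' ++ q'
  ++-cong {p = p} {p'} {q} {q'} p≈ q≈ γ =
    trans (coeff-++ p q γ) (trans (+-cong (p≈ γ) (q≈ γ)) (sym (coeff-++ p' q' γ)))

  -P-cong : ∀ {n} {p q : Poly n} → p ≈P q → -P p ≈P -P q
  -P-cong {p = p} {q} p≈q γ = trans (coeff-neg p γ) (trans (-‿cong (p≈q γ)) (sym (coeff-neg q γ)))

  coeff-* : ∀ {n} (p q : Poly n) γ →
            coeff (p *P q) γ ≈ lin (λ α → lin (λ β → indicator γ (α ⊕ β)) q) p
  coeff-* p q γ = trans (coeff-as-lin (p *P q) γ) (lin-* (indicator γ) p q)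

  *P-cong : ∀ {n} {p p' q q' : Poly n} → p ≈P p' → q ≈P q' → p *P q ≈P p' *P q'
  *P-cong {p = p} {p'} {q} {q'} p≈ q≈ γ = begin
    coeff (p *P q) γ                                   ≈⟨ coeff-* p q γ ⟩
    lin (λ α → lin (λ β → indicator γ (α ⊕ β)) q) p    ≈⟨ lin-cong p (λ α → lin-resp _ q q' q≈) ⟩
    lin (λ α → lin (λ β → indicator γ (α ⊕ β)) q') p   ≈⟨ lin-resp _ p p' p≈ ⟩
    lin (λ α → lin (λ β → indicator γ (α ⊕ β)) q') p'  ≈⟨ sym (coeff-* p' q' γ) ⟩
    coeff (p' *P q') γ                                 ∎

  coeff-scale : ∀ {n} a (q : Poly n) γ → coeff (constP a *P q) γ ≈ a * coeff q γ
  coeff-scale {n} a q γ = begin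
    coeff (constP a *P q) γ                           ≈⟨ coeff-* (constP a) q γ ⟩
    a * lin (λ β → indicator γ (zeros n ⊕ β)) q + 0#  ≈⟨ +-identityʳ _ ⟩
    a * lin (λ β → indicator γ (zeros n ⊕ β)) q
      ≈⟨ *-congˡ (lin-cong q (λ β → reflexive (P.cong (indicator γ) (zeros⊕ β)))) ⟩
    a * lin (indicator γ) q                           ≈⟨ *-congˡ (sym (coeff-as-lin q γ)) ⟩
    a * coeff q γ                                     ∎

  1*P : ∀ {n} (q : Poly n) → 1P *P q ≈P q
  1*P q γ = trans (coeff-scale 1# q γ) (*-identityˡ _)

  1^P : ∀ {n} k → 1P {n} ^P k ≈P 1P
  1^P zero    γ = refl
  1^P (suc k) γ = trans (1*P (1P ^P k) γ) (1^P k γ)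

  1^P* : ∀ {n} k (q : Poly n) → (1P ^P k) *P q ≈P q
  1^P* k q γ = trans (*P-cong {p = 1P ^P k} {1P} {q} {q} (1^P k) (λ _ → refl) γ) (1*P q γ)

  coeff-subst : ∀ {n m} (p : Poly n) (s : Fin n → Poly m) γ →
                coeff (subst p s) γ ≈ lin (λ α → coeff (monoSubst α s) γ) p
  coeff-subst []            s γ = refl
  coeff-subst ((a , α) ∷ p) s γ = trans (coeff-++ (constP a *P monoSubst α s) (subst p s) γ)
    (+-cong (coeff-scale a (monoSubst α s) γ) (coeff-subst p s γ))

  subst-cong : ∀ {n m} {p q : Poly n} (s : Fin n → Poly m) → p ≈P q → subst p s ≈P subst q s
  subst-cong {p = p} {q} s p≈q γ = trans (coeff-subst p s γ) (trans (lin-resp _ p q p≈q) (sym (coeff-subst q s γ)))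

  monoSubst-zeros : ∀ {n m} (s : Fin n → Poly m) → monoSubst (zeros n) s ≈P 1P
  monoSubst-zeros {zero}  s γ = refl
  monoSubst-zeros {suc n} s γ =
    trans (1*P (monoSubst (zeros n) (λ j → s (suc j))) γ) (monoSubst-zeros (λ j → s (suc j)) γ)

  sign : ℕ → Carrier → Carrier
  sign zero          x = x
  sign (suc zero)    x = - x
  sign (suc (suc j)) x = sign j x

  alternating : ℕ → (ℕ → Carrier) → Carrier
  alternating zero    g = 0#
  alternating (suc m) g = alternating m g + sign m (g m)

  sign-cong : ∀ j {x y} → x ≈ y → sign j x ≈ sign j y
  sign-cong zero          x≈y = x≈y
  sign-cong (suc zero)    x≈y = -‿cong x≈y
  sign-cong (suc (suc j)) x≈y = sign-cong j x≈y

  sign-suc : ∀ j x → sign (suc j) x ≈ - sign j x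
  sign-suc zero          x = refl
  sign-suc (suc zero)    x = sym (-‿involutive x)
  sign-suc (suc (suc j)) x = sign-suc j x

  sign-+ : ∀ j x y → sign j (x + y) ≈ sign j x + sign j y
  sign-+ zero          x y = refl
  sign-+ (suc zero)    x y = sym (-‿+-comm x y)
  sign-+ (suc (suc j)) x y = sign-+ j x y

  alternating-cong : ∀ m {g h : ℕ → Carrier} → (∀ j → g j ≈ h j) → alternating m g ≈ alternating m h
  alternating-cong zero    g≈h = refl
  alternating-cong (suc m) g≈h = +-cong (alternating-cong m g≈h) (sign-cong m (g≈h m))

  lin-signed : ∀ {n} (f : Mono n → Carrier) j p → lin f (signed j p) ≈ sign j (lin f p)
  lin-signed f zero          p = refl
  lin-signed f (suc zero)    p = lin-neg f p
  lin-signed f (suc (suc j)) p = lin-signed f j p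

  lin-altSum : ∀ {n} (f : Mono n → Carrier) m ps →
               lin f (altSum m ps) ≈ alternating m (λ j → lin f (ps j))
  lin-altSum f zero    ps = refl
  lin-altSum f (suc m) ps = trans (lin-++ f (altSum m ps) (signed m (ps m)))
    (+-cong (lin-altSum f m ps) (lin-signed f m (ps m)))

  coeff-signed : ∀ {n} j (p : Poly n) γ → coeff (signed j p) γ ≈ sign j (coeff p γ)
  coeff-signed j p γ = trans (coeff-as-lin (signed j p) γ)
    (trans (lin-signed (indicator γ) j p) (sign-cong j (sym (coeff-as-lin p γ))))

  altSum-cong : ∀ {n} m {ps qs : ℕ → Poly n} → (∀ j → ps j ≈P qs j) → altSum m ps ≈P altSum m qs
  altSum-cong m {ps} {qs} ps≈qs γ = begin
    coeff (altSum m ps) γ                          ≈⟨ coeff-as-lin (altSum m ps) γ ⟩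
    lin (indicator γ) (altSum m ps)                ≈⟨ lin-altSum (indicator γ) m ps ⟩
    alternating m (λ j → lin (indicator γ) (ps j))
      ≈⟨ alternating-cong m (λ j → lin-resp (indicator γ) (ps j) (qs j) (ps≈qs j)) ⟩
    alternating m (λ j → lin (indicator γ) (qs j)) ≈⟨ sym (lin-altSum (indicator γ) m qs) ⟩
    lin (indicator γ) (altSum m qs)                ≈⟨ sym (coeff-as-lin (altSum m qs) γ) ⟩
    coeff (altSum m qs) γ                          ∎

  telescope : ∀ (x : ℕ → Carrier) m →
              alternating m (λ j → x (suc j) + x j) ≈ sign (suc m) (x m) + x 0
  telescope x zero    = sym (-‿inverseˡ (x 0))
  telescope x (suc m) = begin
    alternating m (λ j → x (suc j) + x j) + sign m (x (suc m) + x m)  ≈⟨ +-cong (telescope x m) (sign-+ m _ _) ⟩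
    (A + x 0) + (C + B)  ≈⟨ +-congʳ (+-comm A (x 0)) ⟩
    (x 0 + A) + (C + B)  ≈⟨ interchange (x 0) A C B ⟩
    (x 0 + C) + (A + B)  ≈⟨ +-cong (+-comm (x 0) C) (trans (+-congʳ (sign-suc m (x m))) (-‿inverseˡ B)) ⟩
    (C + x 0) + 0#       ≈⟨ +-identityʳ _ ⟩
    C + x 0              ∎
    where
    A = sign (suc m) (x m)
    B = sign m (x m)
    C = sign m (x (suc m))

  Rseq∘F : ∀ {n} (F G : PolyMap n) → (G ∘P F) ≈M idMap → ∀ m i →
           subst (Rseq F G m i) F ≈P signed (suc m) (Pseq F m i)
  Rseq∘F F G G∘F≈X m i γ = begin
    coeff (subst (Rseq F G m i) F) γ                                ≈⟨ coeff-subst (Rseq F G m i) F γ ⟩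
    lin ∘F (altSum m (λ j → Pseq F j i) ++ -P G i)
      ≈⟨ lin-++ ∘F (altSum m (λ j → Pseq F j i)) (-P G i) ⟩
    lin ∘F (altSum m (λ j → Pseq F j i)) + lin ∘F (-P G i)
      ≈⟨ +-cong (lin-altSum ∘F m _) (lin-neg ∘F (G i)) ⟩
    alternating m (λ j → lin ∘F (Pseq F j i)) - lin ∘F (G i)
      ≈⟨ +-cong (alternating-cong m P-step) (-‿cong G-step) ⟩
    alternating m (λ j → x (suc j) + x j) - x 0                     ≈⟨ +-congʳ (telescope x m) ⟩
    (sign (suc m) (x m) + x 0) - x 0                                ≈⟨ //-rightDividesʳ (x 0) _ ⟩
    sign (suc m) (x m)                                              ≈⟨ sym (coeff-signed (suc m) (Pseq F m i) γ) ⟩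
    coeff (signed (suc m) (Pseq F m i)) γ                           ∎
    where
    ∘F : Mono _ → Carrier
    ∘F α = coeff (monoSubst α F) γ
    x : ℕ → Carrier
    x j = coeff (Pseq F j i) γ
    P-step : ∀ j → lin ∘F (Pseq F j i) ≈ x (suc j) + x j
    P-step j = begin
      lin ∘F (Pseq F j i)           ≈⟨ sym (coeff-subst (Pseq F j i) F γ) ⟩
      y                             ≈⟨ sym (//-rightDividesˡ (x j) y) ⟩
      (y - x j) + x j               ≈⟨ +-congʳ (sym (coeff-sub (subst (Pseq F j i) F) (Pseq F j i) γ)) ⟩
      x (suc j) + x j               ∎
      where y = coeff (subst (Pseq F j i) F) γ
    G-step : lin ∘F (G i) ≈ x 0
    G-step = trans (sym (coeff-subst (G i) F γ)) (G∘F≈X i γ)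

  coeff-hat-on : ∀ {n} (p : Poly n) α → coeff (hat p) ((∣ α ∣ₘ ∸ 1) ∷ α) ≈ coeff p α
  coeff-hat-on []            α = refl
  coeff-hat-on ((b , β) ∷ p) α with ≡-dec ℕ._≟_ ((∣ β ∣ₘ ∸ 1) ∷ β) ((∣ α ∣ₘ ∸ 1) ∷ α)
  ... | yes eq with ∷-injectiveʳ eq
  ...   | P.refl = trans (+-congˡ (coeff-hat-on p α)) (sym (coeff-head-on b α p))
  coeff-hat-on ((b , β) ∷ p) α | no ne =
    trans (coeff-hat-on p α) (sym (coeff-head-off b p (λ β≡α → ne (P.cong (λ v → (∣ v ∣ₘ ∸ 1) ∷ v) β≡α))))

  coeff-hat-off : ∀ {n} (p : Poly n) {k α} → ¬ (k ≡ ∣ α ∣ₘ ∸ 1) → coeff (hat p) (k ∷ α) ≈ 0#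
  coeff-hat-off []            off = refl
  coeff-hat-off ((b , β) ∷ p) {k} {α} off with ≡-dec ℕ._≟_ ((∣ β ∣ₘ ∸ 1) ∷ β) (k ∷ α)
  ... | yes eq = ⊥-elim (off (P.trans (P.sym (∷-injectiveˡ eq)) (P.cong (λ v → ∣ v ∣ₘ ∸ 1) (∷-injectiveʳ eq))))
  ... | no  _  = coeff-hat-off p off

  hat-cong : ∀ {n} {p q : Poly n} → p ≈P q → hat p ≈P hat q
  hat-cong {p = p} {q} p≈q (k ∷ α) with k ℕ.≟ (∣ α ∣ₘ ∸ 1)
  ... | yes P.refl = trans (coeff-hat-on p α) (trans (p≈q α) (sym (coeff-hat-on q α)))
  ... | no  off    = trans (coeff-hat-off p off) (sym (coeff-hat-off q off))

  hat-++ : ∀ {n} (p q : Poly n) → hat (p ++ q) ≡ hat p ++ hat q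
  hat-++ []      q = P.refl
  hat-++ (x ∷ p) q = P.cong (_ ∷_) (hat-++ p q)

  hat-neg : ∀ {n} (p : Poly n) → hat (-P p) ≡ -P (hat p)
  hat-neg []            = P.refl
  hat-neg ((a , α) ∷ p) = P.cong ((- a , (∣ α ∣ₘ ∸ 1) ∷ α) ∷_) (hat-neg p)

  hat-signed : ∀ {n} j (p : Poly n) → hat (signed j p) ≡ signed j (hat p)
  hat-signed zero          p = P.refl
  hat-signed (suc zero)    p = hat-neg p
  hat-signed (suc (suc j)) p = hat-signed j p

  hat-altSum : ∀ {n} m (ps : ℕ → Poly n) → hat (altSum m ps) ≡ altSum m (λ j → hat (ps j))
  hat-altSum zero    ps = P.refl
  hat-altSum (suc m) ps = P.trans (hat-++ (altSum m ps) (signed m (ps m)))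
    (P.cong₂ _++_ (hat-altSum m ps) (hat-signed m (ps m)))

  -- q ∈ K[t, X] has weight (c, e) when every monomial t^k X^α occurring in q
  -- satisfies k + c = |α| + e.  For instance t has weight (0, 1), and P̂ has
  -- weight (1, 0) when P(0) = 0.
  Weighted : ∀ {n} → ℕ → ℕ → Poly (suc n) → Set ℓ
  Weighted c e q = ∀ k α → ¬ (k ℕ.+ c ≡ ∣ α ∣ₘ ℕ.+ e) → coeff q (k ∷ α) ≈ 0#

  Weighted-shift : ∀ {n} {c e c' e'} (q : Poly (suc n)) → c ℕ.+ e' ≡ c' ℕ.+ e →
                   Weighted c e q → Weighted c' e' q
  Weighted-shift {c = c} {e} {c'} {e'} q shift wq k α unbalanced =
    wq k α (λ balanced → unbalanced (balance-shift k ∣ α ∣ₘ c e c' e' shift balanced))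

  Weighted-term : ∀ {n} a k₀ (α₀ : Mono n) {c e} → k₀ ℕ.+ c ≡ ∣ α₀ ∣ₘ ℕ.+ e →
                  Weighted c e ((a , k₀ ∷ α₀) ∷ [])
  Weighted-term a k₀ α₀ balanced k α unbalanced with ≡-dec ℕ._≟_ (k₀ ∷ α₀) (k ∷ α)
  ... | yes P.refl = ⊥-elim (unbalanced balanced)
  ... | no  _      = refl

  Weighted-1P : ∀ {n} → Weighted {n} 0 0 1P
  Weighted-1P {n} = Weighted-term 1# 0 (zeros n) (P.cong (ℕ._+ 0) (P.sym (∣zeros∣ n)))

  Weighted-tvar : ∀ {n} → Weighted {n} 0 1 tvar
  Weighted-tvar {n} = Weighted-term 1# 1 (zeros n) (P.cong (ℕ._+ 1) (P.sym (∣zeros∣ n)))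

  Weighted-* : ∀ {n} {c e c' e'} (p q : Poly (suc n)) → Weighted c e p → Weighted c' e' q →
               Weighted (c ℕ.+ c') (e ℕ.+ e') (p *P q)
  Weighted-* {c = c} {e} {c'} {e'} p q wp wq k α unbalanced =
    trans (coeff-* p q (k ∷ α)) (lin-vanishes _ p outer)
    where
    outer : ∀ x → coeff p x * lin (λ y → indicator (k ∷ α) (x ⊕ y)) q ≈ 0#
    outer (k₁ ∷ α₁) with (k₁ ℕ.+ c) ℕ.≟ (∣ α₁ ∣ₘ ℕ.+ e)
    ... | no  off₁ = trans (*-congʳ (wp k₁ α₁ off₁)) (zeroˡ _)
    ... | yes on₁  = trans (*-congˡ (lin-vanishes _ q inner)) (zeroʳ _)
      where
      inner : ∀ y → coeff q y * indicator (k ∷ α) ((k₁ ∷ α₁) ⊕ y) ≈ 0#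
      inner (k₂ ∷ α₂) with (k₂ ℕ.+ c') ℕ.≟ (∣ α₂ ∣ₘ ℕ.+ e')
      ... | no  off₂ = trans (*-congʳ (wq k₂ α₂ off₂)) (zeroˡ _)
      ... | yes on₂  = trans (*-congˡ (indicator-other (λ eq → unbalanced (balanced eq)))) (zeroʳ _)
        where
        balanced : (k₁ ℕ.+ k₂) ∷ (α₁ ⊕ α₂) ≡ k ∷ α → k ℕ.+ (c ℕ.+ c') ≡ ∣ α ∣ₘ ℕ.+ (e ℕ.+ e')
        balanced eq = P.trans (P.cong (ℕ._+ (c ℕ.+ c')) (P.sym (∷-injectiveˡ eq)))
          (P.trans (balance-+ k₁ k₂ ∣ α₁ ∣ₘ ∣ α₂ ∣ₘ c e c' e' on₁ on₂)
            (P.cong (ℕ._+ (e ℕ.+ e')) (P.trans (P.sym (∣⊕∣ α₁ α₂)) (P.cong ∣_∣ₘ (∷-injectiveʳ eq)))))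

  Weighted-^ : ∀ {n} {c e} (p : Poly (suc n)) k → Weighted c e p → Weighted (k ℕ.* c) (k ℕ.* e) (p ^P k)
  Weighted-^ p zero    wp = Weighted-1P
  Weighted-^ p (suc k) wp = Weighted-* p (p ^P k) wp (Weighted-^ p k wp)

  Weighted-monoSubst : ∀ {n m} (α : Mono m) (s : Fin m → Poly (suc n)) → (∀ j → Weighted 1 0 (s j)) →
                       Weighted ∣ α ∣ₘ 0 (monoSubst α s)
  Weighted-monoSubst []      s ws = Weighted-1P
  Weighted-monoSubst (k ∷ α) s ws = Weighted-shift (monoSubst (k ∷ α) s) (shift k ∣ α ∣ₘ)
    (Weighted-* (s zero ^P k) (monoSubst α (λ j → s (suc j)))
      (Weighted-^ (s zero) k (ws zero)) (Weighted-monoSubst α (λ j → s (suc j)) (λ j → ws (suc j))))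
    where
    shift : ∀ a b → (a ℕ.* 1 ℕ.+ b) ℕ.+ 0 ≡ (a ℕ.+ b) ℕ.+ (a ℕ.* 0 ℕ.+ 0)
    shift = solve-∀

  Weighted-hat : ∀ {n} (p : Poly n) → coeff p (zeros n) ≈ 0# → Weighted 1 0 (hat p)
  Weighted-hat {n} p no-constant k α unbalanced with k ℕ.≟ (∣ α ∣ₘ ∸ 1)
  ... | no off = coeff-hat-off p off
  ... | yes P.refl with ∣ α ∣ₘ in ∣α∣≡
  ...   | suc d = ⊥-elim (unbalanced (P.trans (ℕP.+-comm d 1) (P.sym (ℕP.+-identityʳ (suc d)))))
  ...   | zero with ∣∣≡0⇒zeros α ∣α∣≡
  ...     | P.refl = trans (reflexive (P.cong (λ w → coeff (hat p) ((w ∸ 1) ∷ zeros n)) (P.sym ∣α∣≡)))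
                       (trans (coeff-hat-on p (zeros n)) no-constant)

  -- q lies in the image of hat: all its monomials t^k X^α have k = |α| - 1
  -- (weight (1, 0), except that the constant monomial is also allowed).
  HatShaped : ∀ {n} → Poly (suc n) → Set ℓ
  HatShaped q = ∀ k α → ¬ (k ≡ ∣ α ∣ₘ ∸ 1) → coeff q (k ∷ α) ≈ 0#

  Weighted⇒HatShaped : ∀ {n} (q : Poly (suc n)) → Weighted 1 0 q → HatShaped q
  Weighted⇒HatShaped q wq k α off = wq k α (λ balanced → off (balance-1-0 balanced))

  HatShaped-resp : ∀ {n} (p q : Poly (suc n)) → p ≈P q → HatShaped p → HatShaped q
  HatShaped-resp p q p≈q hp k α off = trans (sym (p≈q (k ∷ α))) (hp k α off)

  HatShaped-1P : ∀ {n} → HatShaped {n} 1P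
  HatShaped-1P {n} k α off with ≡-dec ℕ._≟_ (0 ∷ zeros n) (k ∷ α)
  ... | yes P.refl = ⊥-elim (off (P.cong (_∸ 1) (P.sym (∣zeros∣ n))))
  ... | no  _      = refl

  HatShaped-++ : ∀ {n} (p q : Poly (suc n)) → HatShaped p → HatShaped q → HatShaped (p ++ q)
  HatShaped-++ p q hp hq k α off =
    trans (coeff-++ p q (k ∷ α)) (trans (+-cong (hp k α off) (hq k α off)) (+-identityʳ _))

  HatShaped-scale : ∀ {n} a (q : Poly (suc n)) → HatShaped q → HatShaped (constP a *P q)
  HatShaped-scale a q hq k α off = trans (coeff-scale a q (k ∷ α)) (trans (*-congˡ (hq k α off)) (zeroʳ a))

  -- For Φ of weight (1, 0), the image t^(|α|-1) Φ^α of a term of P̂ under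
  -- X ↦ Φ is hat-shaped: it has weight (|α|, |α| - 1) ~ (1, 0) when |α| ≥ 1,
  -- and it is 1 when |α| = 0.  Summing over the terms gives P̂ ∘ Φ.
  HatShaped-term : ∀ {n} (Φ : Fin n → Poly (suc n)) → (∀ j → Weighted 1 0 (Φ j)) → ∀ (α : Mono n) →
                   HatShaped ((tvar ^P (∣ α ∣ₘ ∸ 1)) *P monoSubst α Φ)
  HatShaped-term {n} Φ wΦ α with ∣ α ∣ₘ in ∣α∣≡
  ... | zero with ∣∣≡0⇒zeros α ∣α∣≡
  ...   | P.refl = HatShaped-resp 1P (tvar ^P 0 *P monoSubst (zeros n) Φ)
                     (λ γ → sym (trans (1*P (monoSubst (zeros n) Φ) γ) (monoSubst-zeros Φ γ)))
                     HatShaped-1P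
  HatShaped-term {n} Φ wΦ α | suc d = Weighted⇒HatShaped term (Weighted-shift term (shift d)
      (Weighted-* (tvar ^P d) (monoSubst α Φ) (Weighted-^ tvar d Weighted-tvar) weight-Φ^α))
    where
    term = (tvar ^P d) *P monoSubst α Φ
    weight-Φ^α : Weighted (suc d) 0 (monoSubst α Φ)
    weight-Φ^α = P.subst (λ w → Weighted w 0 (monoSubst α Φ)) ∣α∣≡ (Weighted-monoSubst α Φ wΦ)
    shift : ∀ d → (d ℕ.* 0 ℕ.+ suc d) ℕ.+ 0 ≡ 1 ℕ.+ (d ℕ.* 1 ℕ.+ 0)
    shift = solve-∀

  HatShaped-substT-hat : ∀ {n} (Φ : Fin n → Poly (suc n)) → (∀ j → Weighted 1 0 (Φ j)) →
                         ∀ (p : Poly n) → HatShaped (substT (hat p) Φ)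
  HatShaped-substT-hat Φ wΦ []            k α off = refl
  HatShaped-substT-hat Φ wΦ ((a , α) ∷ p) =
    HatShaped-++ (constP a *P term) (substT (hat p) Φ)
      (HatShaped-scale a term (HatShaped-term Φ wΦ α)) (HatShaped-substT-hat Φ wΦ p)
    where term = (tvar ^P (∣ α ∣ₘ ∸ 1)) *P monoSubst α Φ

  -- Specialising t ↦ 1 (dropping the exponent of t) is a left inverse of hat,
  -- and it is a ring map, so it commutes with substitution.
  atOne : ∀ {n} → Poly (suc n) → Poly n
  atOne = List.map (λ term → (proj₁ term , Vec.tail (proj₂ term)))

  atOne-hat : ∀ {n} (p : Poly n) → atOne (hat p) ≡ p
  atOne-hat []            = P.refl
  atOne-hat ((b , β) ∷ p) = P.cong ((b , β) ∷_) (atOne-hat p)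

  atOne-++ : ∀ {n} (p q : Poly (suc n)) → atOne (p ++ q) ≡ atOne p ++ atOne q
  atOne-++ p q = ListP.map-++ _ p q

  atOne-map : ∀ {n} (g : Carrier × Mono (suc n) → Carrier × Mono (suc n))
              (g′ : Carrier × Mono n → Carrier × Mono n) →
              (∀ b k β → atOne (g (b , k ∷ β) ∷ []) ≡ g′ (b , β) ∷ []) →
              ∀ q → atOne (List.map g q) ≡ List.map g′ (atOne q)
  atOne-map g g′ commutes []                  = P.refl
  atOne-map g g′ commutes ((b , (k ∷ β)) ∷ q) = P.cong₂ _++_ (commutes b k β) (atOne-map g g′ commutes q)

  atOne-* : ∀ {n} (p q : Poly (suc n)) → atOne (p *P q) ≡ atOne p *P atOne q
  atOne-* []                  q = P.refl
  atOne-* ((a , (k ∷ α)) ∷ p) q = P.trans (atOne-++ (List.map _ q) (p *P q))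
    (P.cong₂ _++_ (atOne-map _ _ (λ _ _ _ → P.refl) q) (atOne-* p q))

  atOne-^ : ∀ {n} (p : Poly (suc n)) k → atOne (p ^P k) ≡ atOne p ^P k
  atOne-^ p zero    = P.refl
  atOne-^ p (suc k) = P.trans (atOne-* p (p ^P k)) (P.cong (atOne p *P_) (atOne-^ p k))

  atOne-monoSubst : ∀ {n m} (α : Mono n) (s : Fin n → Poly (suc m)) (s′ : Fin n → Poly m) →
                    (∀ j → atOne (s j) ≡ s′ j) → atOne (monoSubst α s) ≡ monoSubst α s′
  atOne-monoSubst []      s s′ s≡ = P.refl
  atOne-monoSubst (k ∷ α) s s′ s≡ = P.trans (atOne-* (s zero ^P k) (monoSubst α (λ j → s (suc j))))
    (P.cong₂ _*P_ (P.trans (atOne-^ (s zero) k) (P.cong (_^P k) (s≡ zero)))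
                  (atOne-monoSubst α (λ j → s (suc j)) (λ j → s′ (suc j)) (λ j → s≡ (suc j))))

  atOne-substT : ∀ {n} (p : Poly (suc n)) (Φ : Fin n → Poly (suc n)) (Ψ : Fin n → Poly n) →
                 (∀ j → atOne (Φ j) ≡ Ψ j) → atOne (substT p Φ) ≈P subst (atOne p) Ψ
  atOne-substT []                  Φ Ψ Φ≡ γ = refl
  atOne-substT ((a , (k ∷ α)) ∷ p) Φ Ψ Φ≡ γ = begin
    coeff (atOne (constP a *P T ++ substT p Φ)) γ
      ≈⟨ reflexive (P.cong (λ r → coeff r γ) (atOne-++ (constP a *P T) (substT p Φ))) ⟩
    coeff (atOne (constP a *P T) ++ atOne (substT p Φ)) γ
      ≈⟨ coeff-++ (atOne (constP a *P T)) (atOne (substT p Φ)) γ ⟩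
    coeff (atOne (constP a *P T)) γ + coeff (atOne (substT p Φ)) γ
      ≈⟨ +-cong head (atOne-substT p Φ Ψ Φ≡ γ) ⟩
    coeff (constP a *P monoSubst α Ψ) γ + coeff (subst (atOne p) Ψ) γ
      ≈⟨ sym (coeff-++ (constP a *P monoSubst α Ψ) (subst (atOne p) Ψ) γ) ⟩
    coeff (subst (atOne ((a , (k ∷ α)) ∷ p)) Ψ) γ ∎
    where
    T = (tvar ^P k) *P monoSubst α Φ
    atOne-T : atOne T ≡ (1P ^P k) *P monoSubst α Ψ
    atOne-T = P.trans (atOne-* (tvar ^P k) (monoSubst α Φ))
                (P.cong₂ _*P_ (atOne-^ tvar k) (atOne-monoSubst α Φ Ψ Φ≡))
    -- the power of t becomes 1^k = 1
    head : coeff (atOne (constP a *P T)) γ ≈ coeff (constP a *P monoSubst α Ψ) γ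
    head = begin
      coeff (atOne (constP a *P T)) γ
        ≈⟨ reflexive (P.cong (λ r → coeff r γ) (P.trans (atOne-* (constP a) T) (P.cong (constP a *P_) atOne-T))) ⟩
      coeff (constP a *P ((1P ^P k) *P monoSubst α Ψ)) γ
        ≈⟨ coeff-scale a ((1P ^P k) *P monoSubst α Ψ) γ ⟩
      a * coeff ((1P ^P k) *P monoSubst α Ψ) γ
        ≈⟨ *-congˡ (1^P* k (monoSubst α Ψ) γ) ⟩
      a * coeff (monoSubst α Ψ) γ
        ≈⟨ sym (coeff-scale a (monoSubst α Ψ) γ) ⟩
      coeff (constP a *P monoSubst α Ψ) γ ∎

  HatShaped⇒≈hat-atOne : ∀ {n} (q : Poly (suc n)) → HatShaped q → q ≈P hat (atOne q)
  HatShaped⇒≈hat-atOne q hq (k ∷ α) with k ℕ.≟ (∣ α ∣ₘ ∸ 1)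
  ... | no off     = trans (hq k α off) (sym (coeff-hat-off (atOne q) off))
  ... | yes P.refl = begin
    coeff q ((∣ α ∣ₘ ∸ 1) ∷ α)                   ≈⟨ coeff-as-lin q _ ⟩
    lin (indicator ((∣ α ∣ₘ ∸ 1) ∷ α)) q         ≈⟨ lin-agree _ _ q agree ⟩
    lin (λ x → indicator α (Vec.tail x)) q       ≈⟨ sym (coeff-atOne q) ⟩
    coeff (atOne q) α                            ≈⟨ sym (coeff-hat-on (atOne q) α) ⟩
    coeff (hat (atOne q)) ((∣ α ∣ₘ ∸ 1) ∷ α)     ∎
    where
    coeff-atOne : ∀ r → coeff (atOne r) α ≈ lin (λ x → indicator α (Vec.tail x)) r
    coeff-atOne []                  = refl
    coeff-atOne ((b , (j ∷ β)) ∷ r) with ≡-dec ℕ._≟_ β α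
    ... | yes _ = +-cong (sym (*-identityʳ b)) (coeff-atOne r)
    ... | no  _ = trans (sym (+-identityˡ _)) (+-cong (sym (zeroʳ b)) (coeff-atOne r))
    -- off the image of hat q vanishes; on it, both indicators test β = α
    agree : ∀ x → coeff q x ≈ 0# ⊎ indicator ((∣ α ∣ₘ ∸ 1) ∷ α) x ≈ indicator α (Vec.tail x)
    agree (j ∷ β) with j ℕ.≟ (∣ β ∣ₘ ∸ 1)
    ... | no off     = inj₁ (hq j β off)
    ... | yes P.refl = inj₂ (indicator-drop β (≡-dec ℕ._≟_ β α))
      where
      indicator-drop : ∀ β → Dec (β ≡ α) →
                       indicator ((∣ α ∣ₘ ∸ 1) ∷ α) ((∣ β ∣ₘ ∸ 1) ∷ β) ≈ indicator α β
      indicator-drop β (yes P.refl) = trans (indicator-self ((∣ α ∣ₘ ∸ 1) ∷ α)) (sym (indicator-self α))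
      indicator-drop β (no β≢α)     =
        trans (indicator-other {γ = (∣ α ∣ₘ ∸ 1) ∷ α} {(∣ β ∣ₘ ∸ 1) ∷ β} (λ eq → β≢α (∷-injectiveʳ eq)))
              (sym (indicator-other β≢α))

  lowerDegree⇒no-constant : ∀ {n} {p : Poly n} {d} → HasLowerDegree p d → 1 ≤ d → coeff p (zeros n) ≈ 0#
  lowerDegree⇒no-constant {n} (below , _) 1≤d = below (zeros n) (P.subst (ℕ._< _) (P.sym (∣zeros∣ n)) 1≤d)

  XplusH-no-constant : ∀ {n} (H : PolyMap n) → (∀ j → coeff (H j) (zeros n) ≈ 0#) →
                       ∀ j → coeff (XplusH H j) (zeros n) ≈ 0#
  XplusH-no-constant {n} H H0 j = begin
    coeff (var j ++ H j) (zeros n)                   ≈⟨ coeff-++ (var j) (H j) (zeros n) ⟩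
    coeff (var j) (zeros n) + coeff (H j) (zeros n)  ≈⟨ +-cong var-no-constant (H0 j) ⟩
    0# + 0#                                          ≈⟨ +-identityʳ 0# ⟩
    0#                                               ∎
    where
    var-no-constant : coeff (var j) (zeros n) ≈ 0#
    var-no-constant with ≡-dec ℕ._≟_ (unitMono j) (zeros n)
    ... | yes eq = ⊥-elim (ℕP.1+n≢0 (P.trans (P.sym (∣unitMono∣ j)) (P.trans (P.cong ∣_∣ₘ eq) (∣zeros∣ n))))
    ... | no  _  = refl

module HatTransfer {c ℓ} (K : Field c ℓ) where
  open Field K using (_≈_; 0#; refl)
  open Polynomials K
  open Coefficients K

  -- (P ∘ F)^ = P̂ ∘ F̂ whenever F(0) = 0: P̂ ∘ F̂ is hat-shaped, so it is the hat
  -- of its specialisation at t = 1, which is P ∘ F.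
  hat-∘ : ∀ {n} (F : PolyMap n) → (∀ j → coeff (F j) (zeros n) ≈ 0#) → ∀ (p : Poly n) →
          substT (hat p) (hatMap F) ≈P hat (subst p F)
  hat-∘ {n} F F0 p = begin
    P̂∘F̂                            ≈⟨ HatShaped⇒≈hat-atOne P̂∘F̂ hat-shaped ⟩
    hat (atOne P̂∘F̂)                ≈⟨ hat-cong {p = atOne P̂∘F̂} {subst (atOne (hat p)) F} at-one ⟩
    hat (subst (atOne (hat p)) F)  ≡⟨ P.cong (λ r → hat (subst r F)) (atOne-hat p) ⟩
    hat (subst p F)                ∎
    where
    open SetoidReasoning (≈P-setoid (suc n))
    P̂∘F̂ = substT (hat p) (hatMap F)
    hat-shaped : HatShaped P̂∘F̂
    hat-shaped = HatShaped-substT-hat (hatMap F) (λ j → Weighted-hat (F j) (F0 j)) p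
    at-one : atOne P̂∘F̂ ≈P subst (atOne (hat p)) F
    at-one = atOne-substT (hat p) (hatMap F) F (λ j → atOne-hat (F j))

  Qseq≈hat-Pseq : ∀ {n} (F : PolyMap n) → (∀ j → coeff (F j) (zeros n) ≈ 0#) →
                  ∀ l i → Qseq F l i ≈P hat (Pseq F l i)
  Qseq≈hat-Pseq F F0 zero    i γ =
    reflexive (P.cong (λ w → coeff ((1# , (w ∸ 1) ∷ unitMono i) ∷ []) γ) (P.sym (∣unitMono∣ i)))
    where open Field K using (reflexive; 1#)
  Qseq≈hat-Pseq {n} F F0 (suc l) i = begin
    substT Q (hatMap F) -P Q
      ≈⟨ ++-cong {p = substT Q (hatMap F)} {substT P̂ (hatMap F)} { -P Q } { -P P̂ }
           (subst-cong {p = Q} {P̂} _ Q≈P̂) (-P-cong {p = Q} {P̂} Q≈P̂) ⟩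
    substT P̂ (hatMap F) -P P̂
      ≈⟨ ++-cong {p = substT P̂ (hatMap F)} {hat (subst (Pseq F l i) F)} { -P P̂ } { -P P̂ }
           (hat-∘ F F0 (Pseq F l i)) (λ _ → refl) ⟩
    hat (subst (Pseq F l i) F) -P P̂
      ≡⟨ P.sym hat-step ⟩
    hat (Pseq F (suc l) i) ∎
    where
    open SetoidReasoning (≈P-setoid (suc n))
    Q  = Qseq F l i
    P̂ = hat (Pseq F l i)
    Q≈P̂ : Q ≈P P̂
    Q≈P̂ = Qseq≈hat-Pseq F F0 l i
    hat-step : hat (Pseq F (suc l) i) ≡ hat (subst (Pseq F l i) F) -P P̂
    hat-step = P.trans (hat-++ (subst (Pseq F l i) F) (-P Pseq F l i))
                 (P.cong (hat (subst (Pseq F l i) F) ++_) (hat-neg (Pseq F l i)))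

  Sseq≈hat-Rseq : ∀ {n} (F G : PolyMap n) → (∀ j → coeff (F j) (zeros n) ≈ 0#) →
                  ∀ m i → Sseq F G m i ≈P hat (Rseq F G m i)
  Sseq≈hat-Rseq {n} F G F0 m i = begin
    ΣQ -P Ĝ  ≈⟨ ++-cong {p = ΣQ} {ΣP̂} { -P Ĝ } { -P Ĝ } (altSum-cong m Q≈P̂) (λ _ → refl) ⟩
    ΣP̂ -P Ĝ  ≡⟨ P.sym hat-R ⟩
    hat (Rseq F G m i) ∎
    where
    open SetoidReasoning (≈P-setoid (suc n))
    ΣQ  = altSum m (λ j → Qseq F j i)
    ΣP̂ = altSum m (λ j → hat (Pseq F j i))
    Ĝ   = hat (G i)
    Q≈P̂ : ∀ j → Qseq F j i ≈P hat (Pseq F j i)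
    Q≈P̂ j = Qseq≈hat-Pseq F F0 j i
    hat-R : hat (Rseq F G m i) ≡ ΣP̂ -P Ĝ
    hat-R = P.trans (hat-++ _ (-P G i)) (P.cong₂ _++_ (hat-altSum m (λ j → Pseq F j i)) (hat-neg (G i)))

  Sseq∘hatF : ∀ {n} (F G : PolyMap n) → (∀ j → coeff (F j) (zeros n) ≈ 0#) → (G ∘P F) ≈M idMap →
              ∀ m i → substT (Sseq F G m i) (hatMap F) ≈P signed (suc m) (hat (Pseq F m i))
  Sseq∘hatF {n} F G F0 G∘F≈X m i = begin
    substT S (hatMap F)               ≈⟨ subst-cong {p = S} {q = hat R} _ (Sseq≈hat-Rseq F G F0 m i) ⟩
    substT (hat R) (hatMap F)         ≈⟨ hat-∘ F F0 R ⟩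
    hat (subst R F)                   ≈⟨ hat-cong {p = subst R F} {q = signed (suc m) Pₘ} (Rseq∘F F G G∘F≈X m i) ⟩
    hat (signed (suc m) Pₘ)           ≡⟨ hat-signed (suc m) Pₘ ⟩
    signed (suc m) (hat Pₘ)           ∎
    where
    open SetoidReasoning (≈P-setoid (suc n))
    S  = Sseq F G m i
    R  = Rseq F G m i
    Pₘ = Pseq F m i

open import Data.Nat using (_+_; _*_; _^_; _<_)

-- The theorem: only F(0) = 0 (from d_i ≥ 2) and G ∘ F = X are used.
lemma2p3 : ∀ {c ℓ} (K : Field c ℓ) → let open Polynomials K in
    ∀ (n : ℕ) (H : PolyMap n) (G : PolyMap n) (ds Ds : Fin n → ℕ) →
    (∀ i → HasDegree (H i) (Ds i)) →
    (∀ i → HasLowerDegree (H i) (ds i)) →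
    (∀ i → 2 ≤ ds i) →
    (G ∘P XplusH H) ≈M idMap → (XplusH H ∘P G) ≈M idMap →
    ∀ (i : Fin n) (m : ℕ) → 1 ≤ m →
    maxFin Ds ^ (n ∸ 1) < (m ∸ 1) * (minFin ds ∸ 1) + ds i →
    (Sseq (XplusH H) G m i ≈P hat (Rseq (XplusH H) G m i))
      × (substT (Sseq (XplusH H) G m i) (hatMap (XplusH H))
          ≈P signed (suc m) (hat (Pseq (XplusH H) m i)))
lemma2p3 K n H G ds Ds _ lowerDeg 2≤d G∘F≈X _ i m _ _ =
  Sseq≈hat-Rseq F G F0 m i , Sseq∘hatF F G F0 G∘F≈X m i
  where
  open Field K using (_≈_; 0#)
  open Polynomials K
  open Coefficients K using (zeros; lowerDegree⇒no-constant; XplusH-no-constant)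
  open HatTransfer K
  F : PolyMap n
  F = XplusH H
  F0 : ∀ j → coeff (F j) (zeros n) ≈ 0#
  F0 = XplusH-no-constant H
         (λ j → lowerDegree⇒no-constant {p = H j} (lowerDeg j) (ℕP.≤-trans (s≤s ℕ.z≤n) (2≤d j)))
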